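{- Let $m\ge1$ and let $(T_1,T_2)$ be a $2$-tiling of the Aztec diamond of rank $m$ with no interactions. For $1\le i\le m$, the $i$-th path of $T_1$ begins with $\min(i,m-i+1)$ horizontal steps and the $i$-th path of $T_2$ begins with $\min(i-1,m-i+1)$ horizontal steps. Equivalently: (1) if $i<\frac{m+1}{2}$, the $i$-th path of $T_1$ starts with $i$ horizontal steps and the $i$-th path of $T_2$ starts with $i-1$ horizontal steps; (2) if $i=\lfloor \frac m2+1\rfloor$, the $i$-th path of $T_1$ consists only of horizontal steps and the $i$-th path of $T_2$ starts with $i-1$ horizontal steps; (3) if $i\ge\lceil\frac m2+1\rceil$, the $i$-th paths of $T_1$ and $T_2$ both consist only of horizontal steps.
   Context: The Aztec diamond of rank $m$ is the union of the closed unit squares $[a,a+1]\times[b,b+1]$ ($a,b\in\mathbb Z$) contained in $\{|x|+|y|\le m+1\}$; a square is gray if $a+b+m$ is even and white otherwise. A $2$-tiling is a pair $(T_1,T_2)$ of domino tilings of it. Interactions: for a tiling $T$ and a gray square $g$, let $d_T(g)\in\{N,E,S,W\}$ be the direction from $g$ to the white square covered together with $g$ by a domino of $T$; $g$ is an interaction of $(T_1,T_2)$ if $(d_{T_1}(g),d_{T_2}(g))\in\{(N,W),(S,S),(W,S),(N,S)\}$. Paths: to each domino of a tiling $T$ associate a segment: for a vertical domino with gray lower square, the segment from the midpoint of the left side of its upper square to the midpoint of the right side of its lower square (a step $(1,-1)$); for a vertical domino with white lower square, the segment from the midpoint of the left side of its lower square to the midpoint of the right side of its upper square (a step $(1,1)$);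 for a horizontal domino whose right square is gray, the segment joining the midpoints of its left and right sides (a horizontal step $(2,0)$); a horizontal domino whose left square is gray gets no segment. The union of these segments is a family of $m$ non-intersecting paths, the $i$-th path going from $(-m-1+i,-i+\frac12)$ to $(m+1-i,-i+\frac12)$; this gives a bijection between domino tilings and such path families. -}

module Defs where

open import Data.Nat as ℕ using (ℕ; zero; suc; _≤ᵇ_; _≡ᵇ_; _%_)
open import Data.Integer as ℤ using (ℤ; +_; ∣_∣; -_)
open import Data.Bool using (Bool; true; false; _∧_; if_then_else_)
open import Data.Product using (_×_; _,_)
open import Data.List using (List; []; _∷_; take; replicate)
open import Relation.Binary.PropositionalEquality using (_≡_)
open import Relation.Nullary using (¬_)

-- A unit square [a,a+1]×[b,b+1] is named by its lower-left corner (a , b).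

inADᵇ : ℕ → ℤ → ℤ → Bool
inADᵇ m a b =
  ((∣ a ∣ ℕ.+ ∣ b ∣) ≤ᵇ suc m) ∧
  ((∣ a ℤ.+ + 1 ∣ ℕ.+ ∣ b ∣) ≤ᵇ suc m) ∧
  ((∣ a ∣ ℕ.+ ∣ b ℤ.+ + 1 ∣) ≤ᵇ suc m) ∧
  ((∣ a ℤ.+ + 1 ∣ ℕ.+ ∣ b ℤ.+ + 1 ∣) ≤ᵇ suc m)

InAD : ℕ → ℤ → ℤ → Set
InAD m a b = inADᵇ m a b ≡ true

-- gray iff a + b + m is even (|n| has the same parity as n)
grayᵇ : ℕ → ℤ → ℤ → Bool
grayᵇ m a b = (∣ a ℤ.+ b ℤ.+ + m ∣ % 2) ≡ᵇ 0

Gray : ℕ → ℤ → ℤ → Set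
Gray m a b = grayᵇ m a b ≡ true

data Dir : Set where
  N E S W : Dir

opp : Dir → Dir
opp N = S
opp S = N
opp E = W
opp W = E

moveA : Dir → ℤ → ℤ
moveA N a = a
moveA S a = a
moveA E a = a ℤ.+ + 1
moveA W a = a ℤ.- + 1

moveB : Dir → ℤ → ℤ
moveB N b = b ℤ.+ + 1
moveB S b = b ℤ.- + 1
moveB E b = b
moveB W b = b

-- A domino tiling of the Aztec diamond of rank m, given as a perfect matching
-- of its squares: dir a b is the direction from square (a,b) to the square
-- covered together with it by a domino.  (Values outside the diamond are
-- irrelevant.)
record Tiling (m : ℕ) : Set where
  field
    dir     : ℤ → ℤ → Dir
    inside  : ∀ a b → InAD m a b → InAD m (moveA (dir a b) a) (moveB (dir a b) b)
    partner : ∀ a b → InAD m a b →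
              dir (moveA (dir a b) a) (moveB (dir a b) b) ≡ opp (dir a b)
open Tiling public

data InteractionPair : Dir → Dir → Set where
  NW : InteractionPair N W
  SS : InteractionPair S S
  WS : InteractionPair W S
  NS : InteractionPair N S

IsInteraction : {m : ℕ} → Tiling m → Tiling m → ℤ → ℤ → Set
IsInteraction {m} T₁ T₂ a b =
  InAD m a b × Gray m a b × InteractionPair (dir T₁ a b) (dir T₂ a b)

NoInteractions : {m : ℕ} → Tiling m → Tiling m → Set
NoInteractions T₁ T₂ = ∀ a b → ¬ IsInteraction T₁ T₂ a b

-- Steps of a lattice path: (1,1), (1,-1), (2,0).
data Step : Set where
  up down hor : Step

-- The segment (if any) starting at the midpoint of the left side of square
-- (a,b): it exists iff (a,b) is a white square of the diamond not matched to
-- its left neighbour; matched north = vertical domino with white lower square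
-- (step (1,1)); matched south = vertical domino with gray lower square (step
-- (1,-1)); matched east = horizontal domino with gray right square (step (2,0)).
-- walk follows the segments from the left midpoint of square (a,b), with fuel.
walk : {m : ℕ} → Tiling m → ℕ → ℤ → ℤ → List Step
walk T zero a b = []
walk {m} T (suc n) a b with inADᵇ m a b | grayᵇ m a b
... | false | _    = []
... | true  | true = []
... | true  | false with dir T a b
...   | N = up   ∷ walk T n (a ℤ.+ + 1) (b ℤ.+ + 1)
...   | S = down ∷ walk T n (a ℤ.+ + 1) (b ℤ.- + 1)
...   | E = hor  ∷ walk T n (a ℤ.+ + 2) b
...   | W = []

-- The i-th path of T (1 ≤ i ≤ m), starting at (-m-1+i, -i+1/2), the left
-- midpoint of square (-m-1+i, -i), as its list of steps from left to right.
-- Fuel 2(m+1) exceeds the number of steps of any path.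
path : {m : ℕ} → Tiling m → ℕ → List Step
path {m} T i = walk T (2 ℕ.* suc m) (+ i ℤ.- + suc m) (- (+ i))

BeginsWithHor : List Step → ℕ → Set
BeginsWithHor ps k = take k ps ≡ replicate k hor

{-# OPTIONS --safe #-}
module Submission where

-- Index the squares so that the i-th path meets column j in the white square (j, j + i) (see
-- Matching). We show, column by column, that this square points east in T₁ whenever j < i and in
-- T₂ whenever j + 1 < i. A square pointing west or south would claim the gray square already taken
-- by the east-pointing square of the previous column, and a square of T₂ pointing north gives the
-- interaction (W, S) with T₁. Likewise a square of T₁ pointing north would clash with the square above
-- it, unless it lies on the diagonal k = 2c + 1; there the square of T₂ must point east (north is the
-- interaction (S, S)), so the (c + 1)-st paths of T₁ and T₂ part at it with the path of T₂ below. The interactions (N, S), (N, W), (W, S) being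
-- excluded, the path of T₂ stays strictly below and leaves the diamond in an earlier column; but in
-- every tiling the i-th path leaves the diamond in column m + 1 - i.

open import Defs
open import Data.Nat
open import Data.Nat.Properties
open import Data.Nat.Induction using (<-rec)
open import Data.Nat.DivMod using (m*n%n≡0; [m+kn]%n≡m%n)
open import Data.Nat.Tactic.RingSolver using (solve-∀)
open import Algebra.Properties.CommutativeSemigroup +-commutativeSemigroup using (x∙yz≈y∙xz)
open import Data.Integer as ℤ using (ℤ; +_; -[1+_]; ∣_∣)
import Data.Integer.Properties as ℤᵖ
open import Data.Integer.Tactic.RingSolver renaming (solve-∀ to ℤ-solve-∀)
open import Data.Bool using (T; false)
open import Data.Bool.Properties using (T-≡; T-∧)
open import Data.List using (_∷_; take; replicate)
open import Data.Product using (_×_; _,_; proj₁; proj₂; ∃)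
open import Data.Sum using (_⊎_; inj₁; inj₂)
open import Data.Empty using (⊥; ⊥-elim)
open import Function using (_∘_; _$_; Equivalence)
open import Relation.Binary.PropositionalEquality
open import Relation.Nullary using (¬_)

clash : ∀ {x y z : Dir} → x ≡ y → x ≡ z → y ≢ z → ⊥
clash refl refl y≢z = y≢z refl

-- A tiling in coordinates adapted to the paths: for 0 ≤ c ≤ m and 1 ≤ k ≤ m the white square (c, k)
-- has lower-left corner (c + k - m - 1, c - k), and the gray square (c, k) is its east neighbour.
-- The i-th path starts in the white square (0, i), and its steps up, down and horizontal from the
-- white square (c, k) (matched N, S and E) lead to the white squares (c + 1, k), (c, k + 1) and
-- (c + 1, k + 1).
record Matching (m : ℕ) : Set where
  field
    white gray : ℕ → ℕ → Dir
    white-N : ∀ {c k} → c ≤ m → suc k ≤ m → white c (suc k) ≡ N → c < m × gray c k ≡ S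
    white-E : ∀ {c k} → c ≤ m → 1 ≤ k → k ≤ m → white c k ≡ E → c < m × gray c k ≡ W
    white-S : ∀ {c k} → suc c ≤ m → 1 ≤ k → k ≤ m → white (suc c) k ≡ S → gray c k ≡ N
    white-W : ∀ {c k} → suc c ≤ m → suc k ≤ m → white (suc c) (suc k) ≡ W → gray c k ≡ E
    edge-S  : ∀ {k} → 1 ≤ k → k ≤ m → white 0 k ≢ S
    edge-W  : ∀ {k} → 1 ≤ k → k ≤ m → white 0 k ≢ W

module Paths {m : ℕ} (T : Matching m) where
  open Matching T

  -- Exit c k e : the path through the white square (c, k) leaves the diamond in column e.
  data Exit : ℕ → ℕ → ℕ → Set where
    leave : ∀ {c} → Exit c (suc m) c
    viaN  : ∀ {c k e} → c ≤ m → 1 ≤ k → k ≤ m → white c k ≡ N → Exit (suc c) k e → Exit c k e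
    viaS  : ∀ {c k e} → c ≤ m → 1 ≤ k → k ≤ m → white c k ≡ S → Exit c (suc k) e → Exit c k e
    viaE  : ∀ {c k e} → c ≤ m → 1 ≤ k → k ≤ m → white c k ≡ E → Exit (suc c) (suc k) e → Exit c k e

  exit-column-≥ : ∀ {c k e} → Exit c k e → c ≤ e
  exit-column-≥ leave            = ≤-refl
  exit-column-≥ (viaN _ _ _ _ D) = <⇒≤ (exit-column-≥ D)
  exit-column-≥ (viaS _ _ _ _ D) = exit-column-≥ D
  exit-column-≥ (viaE _ _ _ _ D) = <⇒≤ (exit-column-≥ D)

  exit-row-≤ : ∀ {c k e} → Exit c k e → k ≤ suc m
  exit-row-≤ leave              = ≤-refl
  exit-row-≤ (viaN _ _ k≤m _ _) = m≤n⇒m≤1+n k≤m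
  exit-row-≤ (viaS _ _ k≤m _ _) = m≤n⇒m≤1+n k≤m
  exit-row-≤ (viaE _ _ k≤m _ _) = m≤n⇒m≤1+n k≤m

  exit-column-≤ : ∀ {c k e} → c ≤ m → Exit c k e → e ≤ m
  exit-column-≤ c≤m leave                        = c≤m
  exit-column-≤ _   (viaN c≤m (s≤s z≤n) k≤m w D) = exit-column-≤ (proj₁ (white-N c≤m k≤m w)) D
  exit-column-≤ c≤m (viaS _ _ _ _ D)             = exit-column-≤ c≤m D
  exit-column-≤ _   (viaE c≤m 1≤k k≤m w D)       = exit-column-≤ (proj₁ (white-E c≤m 1≤k k≤m w)) D

  exit-column-pos : ∀ {k e} → k ≤ m → Exit 0 k e → 1 ≤ e
  exit-column-pos k≤m leave                = ⊥-elim (1+n≰n k≤m)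
  exit-column-pos _   (viaN _ _ _ _ D)     = exit-column-≥ D
  exit-column-pos _   (viaS _ 1≤k k≤m w _) = ⊥-elim (edge-S 1≤k k≤m w)
  exit-column-pos _   (viaE _ _ _ _ D)     = exit-column-≥ D

  exit-exists : ∀ {c k} → c ≤ m → 1 ≤ k → k ≤ suc m → (k ≤ m → white c k ≢ W) → ∃ (Exit c k)
  exit-exists c≤m 1≤k k≤m+1 = go (≤⇒≤‴ c≤m) (≤⇒≤‴ k≤m+1) 1≤k
    where
    row-≤ : ∀ {k} → k <‴ suc m → k ≤ m
    row-≤ = ≤-pred ∘ ≤‴⇒≤

    go : ∀ {c k} → c ≤‴ m → k ≤‴ suc m → 1 ≤ k → (k ≤ m → white c k ≢ W) → ∃ (Exit c k)
    go {c} _ ≤‴-refl _ _ = c , leave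
    go {c} {suc k} _ (≤‴-step k<m+1) (s≤s z≤n) ¬W with white c (suc k) in w
    ... | W = ⊥-elim (¬W (row-≤ k<m+1) refl)
    go ≤‴-refl (≤‴-step k<m+1) _ _ | N =
      ⊥-elim (<-irrefl refl (proj₁ (white-N ≤-refl (row-≤ k<m+1) w)))
    go ≤‴-refl (≤‴-step k<m+1) _ _ | E =
      ⊥-elim (<-irrefl refl (proj₁ (white-E ≤-refl (s≤s z≤n) (row-≤ k<m+1) w)))
    go (≤‴-step c<m) (≤‴-step k<m+1) _ _ | N =
      let gS = proj₂ (white-N (<⇒≤ (≤‴⇒≤ c<m)) (row-≤ k<m+1) w)
          e , D = go c<m (≤‴-step k<m+1) (s≤s z≤n)
                    (λ _ w′ → clash (white-W (≤‴⇒≤ c<m) (row-≤ k<m+1) w′) gS λ ())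
      in e , viaN (<⇒≤ (≤‴⇒≤ c<m)) (s≤s z≤n) (row-≤ k<m+1) w D
    go (≤‴-step c<m) (≤‴-step k<m+1) _ _ | E =
      let gW = proj₂ (white-E (<⇒≤ (≤‴⇒≤ c<m)) (s≤s z≤n) (row-≤ k<m+1) w)
          e , D = go c<m k<m+1 (s≤s z≤n) (λ k′≤m w′ → clash (white-W (≤‴⇒≤ c<m) k′≤m w′) gW λ ())
      in e , viaE (<⇒≤ (≤‴⇒≤ c<m)) (s≤s z≤n) (row-≤ k<m+1) w D
    go {zero} _ (≤‴-step k<m+1) _ _ | S = ⊥-elim (edge-S (s≤s z≤n) (row-≤ k<m+1) w)
    go {suc c} c<m (≤‴-step k<m+1) _ _ | S =
      let gN = white-S (≤‴⇒≤ c<m) (s≤s z≤n) (row-≤ k<m+1) w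
          e , D = go c<m k<m+1 (s≤s z≤n) (λ k′≤m w′ → clash (white-W (≤‴⇒≤ c<m) k′≤m w′) gN λ ())
      in e , viaS (≤‴⇒≤ c<m) (s≤s z≤n) (row-≤ k<m+1) w D

  rewind : ∀ {i c e} → 1 ≤ i → c + i ≤ m → (∀ {j} → j < c → white j (j + i) ≡ E) →
           Exit c (c + i) e → Exit 0 i e
  rewind {c = zero}  _   _     _    D = D
  rewind {c = suc c} 1≤i c+i<m east D =
    rewind 1≤i (<⇒≤ c+i<m) (east ∘ m<n⇒m<1+n)
      (viaE (≤-trans (m≤m+n c _) (<⇒≤ c+i<m)) (≤-trans 1≤i (m≤n+m _ c)) (<⇒≤ c+i<m) (east ≤-refl) D)

data Crossing : Dir → Dir → Set where
  NS : Crossing N S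
  NW : Crossing N W
  WS : Crossing W S

crossing-irrefl : ∀ {X} → ¬ Crossing X X
crossing-irrefl ()

crossing⇒interaction : ∀ {X Y} → Crossing X Y → InteractionPair X Y
crossing⇒interaction NS = NS
crossing⇒interaction NW = NW
crossing⇒interaction WS = WS

module Separation {m : ℕ} (T₁ T₂ : Matching m)
  (no-crossing : ∀ {c k} → c < m → k ≤ m → ¬ Crossing (Matching.gray T₁ c k) (Matching.gray T₂ c k))
  where
  open Matching
  module P₁ = Paths T₁
  module P₂ = Paths T₂

  crossing : ∀ {c k X Y} → c < m → k ≤ m → gray T₁ c k ≡ X → gray T₂ c k ≡ Y → ¬ Crossing X Y
  crossing c<m k≤m refl refl = no-crossing c<m k≤m

  data Entered : ℕ → ℕ → Set where
    start  : ∀ {k} → Entered 0 k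
    afterN : ∀ {c k} → gray T₂ c k ≡ S → Entered (suc c) (suc k)
    afterE : ∀ {c k} → gray T₂ c k ≡ W → Entered (suc c) (suc k)

  data Advanced : ℕ → ℕ → ℕ → Set where
    byN : ∀ {c k} → Advanced c k k
    byE : ∀ {c k} → c < m → k ≤ m → gray T₁ c k ≡ W → Advanced c k (suc k)

  advanced-≤ : ∀ {c k k′} → Advanced c k k′ → k′ ≤ suc k
  advanced-≤ byN         = n≤1+n _
  advanced-≤ (byE _ _ _) = ≤-refl

  -- The two paths are compared column by column: Entered c k₂ says that the path of T₂ has just
  -- arrived in column c, and Advanced c k₁ k₁′ that the path of T₁ went on from row k₁ of column c to
  -- row k₁′ of column c + 1. The path of T₁ can only reach the row of the path of T₂ by stepping down
  -- onto the square where T₂ arrived (pairs NS, NW), or right into the row where T₂ steps up (WS).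
  exit-below : ∀ {c k₁ k₂ e₁ e₂} → k₁ < k₂ → P₁.Exit c k₁ e₁ → P₂.Exit c k₂ e₂ → Entered c k₂ → e₂ < e₁
  exit-below-advanced : ∀ {c k₁ k₁′ k₂ e₁ e₂} → k₁ < k₂ → Advanced c k₁ k₁′ →
                        P₁.Exit (suc c) k₁′ e₁ → P₂.Exit c k₂ e₂ → e₂ < e₁

  exit-below k₁<k₂ P₁.leave D₂ _ = ⊥-elim (1+n≰n (≤-trans k₁<k₂ (P₂.exit-row-≤ D₂)))
  exit-below _ (P₁.viaS _ 1≤k k≤m w _) _ start = ⊥-elim (edge-S T₁ 1≤k k≤m w)
  exit-below {suc c} k₁<k₂ (P₁.viaS c<m 1≤k k≤m w D₁) D₂ entered with m≤n⇒m<n∨m≡n k₁<k₂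
  ... | inj₁ k₁+1<k₂ = exit-below k₁+1<k₂ D₁ D₂ entered
  ... | inj₂ refl with entered
  ...   | afterN gS = ⊥-elim $ crossing c<m k≤m (white-S T₁ c<m 1≤k k≤m w) gS NS
  ...   | afterE gW = ⊥-elim $ crossing c<m k≤m (white-S T₁ c<m 1≤k k≤m w) gW NW
  exit-below k₁<k₂ (P₁.viaN _ _ _ _ D₁) D₂ _ = exit-below-advanced k₁<k₂ byN D₁ D₂
  exit-below k₁<k₂ (P₁.viaE c≤m 1≤k k≤m w D₁) D₂ _ =
    let c<m , gW = white-E T₁ c≤m 1≤k k≤m w in exit-below-advanced k₁<k₂ (byE c<m k≤m gW) D₁ D₂

  exit-below-advanced _ _ D₁ P₂.leave = P₁.exit-column-≥ D₁
  exit-below-advanced k₁<k₂ adv D₁ (P₂.viaS _ _ _ _ D₂) =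
    exit-below-advanced (m<n⇒m<1+n k₁<k₂) adv D₁ D₂
  exit-below-advanced k₁<k₂ adv D₁ (P₂.viaE c≤m 1≤k k≤m w D₂) =
    exit-below (s≤s (≤-trans (advanced-≤ adv) k₁<k₂)) D₁ D₂ (afterE (proj₂ (white-E T₂ c≤m 1≤k k≤m w)))
  exit-below-advanced k₁<k₂ byN D₁ (P₂.viaN c≤m (s≤s z≤n) k≤m w D₂) =
    exit-below k₁<k₂ D₁ D₂ (afterN (proj₂ (white-N T₂ c≤m k≤m w)))
  exit-below-advanced (s≤s k₁≤k₂) (byE c<m k≤m gW) D₁ (P₂.viaN c≤m (s≤s z≤n) k₂≤m w D₂)
    with m≤n⇒m<n∨m≡n k₁≤k₂
  ... | inj₁ k₁<k₂ = exit-below (s≤s k₁<k₂) D₁ D₂ (afterN (proj₂ (white-N T₂ c≤m k₂≤m w)))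
  ... | inj₂ refl  = ⊥-elim $ crossing c<m k≤m gW (proj₂ (white-N T₂ c≤m k₂≤m w)) WS

module Endpoints {m : ℕ} (T : Matching m) where
  open Matching T
  open Paths T
  open Separation T T (λ _ _ → crossing-irrefl) using (exit-below; start)

  path-exists : ∀ {i} → 1 ≤ i → i ≤ m → ∃ (Exit 0 i)
  path-exists 1≤i i≤m = exit-exists z≤n 1≤i (m≤n⇒m≤1+n i≤m) (λ _ → edge-W 1≤i i≤m)

  exits-decrease : ∀ {i e e′} → Exit 0 i e → Exit 0 (suc i) e′ → e′ < e
  exits-decrease D D′ = exit-below ≤-refl D D′ start

  exit-upper : ∀ {i e} → suc i ≤ m → Exit 0 (suc i) e → i + e ≤ m
  exit-upper {zero}  _     D = exit-column-≤ z≤n D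
  exit-upper {suc i} i+1<m D =
    let _ , D′ = path-exists (s≤s z≤n) (<⇒≤ i+1<m)
    in ≤-trans (+-monoʳ-< i (exits-decrease D′ D)) (exit-upper (<⇒≤ i+1<m) D′)

  exit-lower : ∀ t {i e} → t + suc i ≡ m → Exit 0 (suc i) e → m ≤ i + e
  exit-lower zero {i} refl D =
    ≤-trans (≤-reflexive (+-comm 1 i)) (+-monoʳ-≤ i (exit-column-pos ≤-refl D))
  exit-lower (suc t) {i} t+i+1≡m D =
    let t+i+2≡m = trans (+-suc t (suc i)) t+i+1≡m
        _ , D′ = path-exists (s≤s z≤n) (subst (_ ≤_) t+i+2≡m (m≤n+m _ t))
    in ≤-trans (exit-lower t t+i+2≡m D′) (+-monoʳ-< i (exits-decrease D D′))

  exit-column : ∀ {i e} → suc i ≤ m → Exit 0 (suc i) e → i + e ≡ m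
  exit-column i<m D = ≤-antisym (exit-upper i<m D) (exit-lower _ (m∸n+n≡m i<m) D)

twice-suc : ∀ δ c → δ + (suc c + suc c) ≡ 2 + (δ + (c + c))
twice-suc = solve-∀

module Region {m : ℕ} (T : Matching m) where
  open Matching T

  -- East δ c : the white squares of column c below row δ + 2c point east. The i-th path meets
  -- column j in row j + i, so East 0 j and East 1 j give horizontal steps while j < i, resp. j + 1 < i.
  East : ℕ → ℕ → Set
  East δ c = ∀ {k} → δ + (c + c) < k → k ≤ m → white c k ≡ E

  east-on-path : ∀ {δ j i} → East δ j → δ + j < i → j + i ≤ m → white j (j + i) ≡ E
  east-on-path {δ} {j} {i} east δ+j<i = east (subst (_< j + i) (x∙yz≈y∙xz j δ j) (+-monoʳ-< j δ+j<i))

  column-bound : ∀ δ {c k} → δ + (c + c) ≤ k → k ≤ m → c ≤ m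
  column-bound δ {c} δ+2c≤k k≤m = ≤-trans (≤-trans (m≤m+n c c) (m≤n+m _ δ)) (≤-trans δ+2c≤k k≤m)

  ¬west : ∀ δ {c k} → (∀ {j} → j < c → East δ j) → δ + (c + c) ≤ k → 1 ≤ k → k ≤ m → white c k ≢ W
  ¬west _ {zero} _ _ 1≤k k≤m = edge-W 1≤k k≤m
  ¬west δ {suc c} {suc k} east<c δ+2c≤k (s≤s z≤n) k+1≤m w =
    clash (white-W c+1≤m k+1≤m w) (proj₂ (white-E (<⇒≤ c+1≤m) 1≤k k≤m (east<c ≤-refl δ+2c<k k≤m))) λ ()
    where
    c+1≤m : suc c ≤ m
    c+1≤m = column-bound δ δ+2c≤k k+1≤m
    k≤m : k ≤ m
    k≤m = <⇒≤ k+1≤m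
    δ+2c<k : δ + (c + c) < k
    δ+2c<k = ≤-pred (subst (_≤ suc k) (twice-suc δ c) δ+2c≤k)
    1≤k : 1 ≤ k
    1≤k = ≤-trans (s≤s z≤n) δ+2c<k

  ¬south : ∀ δ {c k} → (∀ {j} → j < c → East δ j) → δ + (c + c) ≤ k → 1 ≤ k → k ≤ m → white c k ≢ S
  ¬south _ {zero} _ _ 1≤k k≤m = edge-S 1≤k k≤m
  ¬south δ {suc c} {k} east<c δ+2c≤k 1≤k k≤m w =
    clash (white-S c+1≤m 1≤k k≤m w) (proj₂ (white-E (<⇒≤ c+1≤m) 1≤k k≤m (east<c ≤-refl δ+2c<k k≤m))) λ ()
    where
    c+1≤m : suc c ≤ m
    c+1≤m = column-bound δ δ+2c≤k k≤m
    δ+2c<k : δ + (c + c) < k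
    δ+2c<k = ≤-trans (n≤1+n _) (subst (_≤ k) (twice-suc δ c) δ+2c≤k)

module Horizontal {m : ℕ} (T₁ T₂ : Matching m)
  (no-interaction : ∀ {c k} → c < m → k ≤ m →
                    ¬ InteractionPair (Matching.gray T₁ c k) (Matching.gray T₂ c k))
  where
  open Matching
  module P₁ = Paths T₁
  module P₂ = Paths T₂
  module R₁ = Region T₁
  module R₂ = Region T₂
  open Separation T₁ T₂ (λ c<m k≤m → no-interaction c<m k≤m ∘ crossing⇒interaction)
    using (exit-below; afterE)
  open Endpoints using (exit-column)

  East₁ East₂ : ℕ → Set
  East₁ = R₁.East 0
  East₂ = R₂.East 1

  interaction : ∀ {c k X Y} → c < m → k ≤ m → gray T₁ c k ≡ X → gray T₂ c k ≡ Y → ¬ InteractionPair X Y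
  interaction c<m k≤m refl refl = no-interaction c<m k≤m

  exit-columns-agree : ∀ {i e₁ e₂} → suc i ≤ m → P₁.Exit 0 (suc i) e₁ → P₂.Exit 0 (suc i) e₂ → e₁ ≡ e₂
  exit-columns-agree i<m D₁ D₂ =
    +-cancelˡ-≡ _ _ _ (trans (exit-column T₁ i<m D₁) (sym (exit-column T₂ i<m D₂)))

  diagonal-bound : ∀ {c j} → j ≤ c → suc (c + c) ≤ m → j + suc c ≤ m
  diagonal-bound {c} j≤c k≤m = ≤-trans (+-monoˡ-≤ (suc c) j≤c) (subst (_≤ m) (sym (+-suc c c)) k≤m)

  paths-part-on-diagonal : ∀ {c} → (∀ {j} → j < c → East₁ j × East₂ j) → suc (c + c) ≤ m →
                           white T₁ c (suc (c + c)) ≡ N → white T₂ c (suc (c + c)) ≢ E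
  paths-part-on-diagonal {c} east<c k≤m w₁ w₂ =
    <-irrefl (sym (exit-columns-agree c<m full₁ full₂))
             (exit-below ≤-refl (proj₂ D₁) (proj₂ D₂) (afterE g₂W))
    where
    c<m : c < m
    c<m = diagonal-bound z≤n k≤m
    g₁S : gray T₁ c (c + c) ≡ S
    g₁S = proj₂ (white-N T₁ (<⇒≤ c<m) k≤m w₁)
    g₂W : gray T₂ c (suc (c + c)) ≡ W
    g₂W = proj₂ (white-E T₂ (<⇒≤ c<m) (s≤s z≤n) k≤m w₂)
    D₁ : ∃ (P₁.Exit (suc c) (suc (c + c)))
    D₁ = P₁.exit-exists c<m (s≤s z≤n) (m≤n⇒m≤1+n k≤m) (λ _ w → clash (white-W T₁ c<m k≤m w) g₁S λ ())
    D₂ : ∃ (P₂.Exit (suc c) (suc (suc (c + c))))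
    D₂ = P₂.exit-exists c<m (s≤s z≤n) (s≤s k≤m) (λ k+1≤m w → clash (white-W T₂ c<m k+1≤m w) g₂W λ ())
    on-diagonal : suc (c + c) ≡ c + suc c
    on-diagonal = sym (+-suc c c)
    full₁ : P₁.Exit 0 (suc c) (proj₁ D₁)
    full₁ = P₁.rewind (s≤s z≤n) (diagonal-bound ≤-refl k≤m)
      (λ j<c → R₁.east-on-path (proj₁ (east<c j<c)) (m<n⇒m<1+n j<c) (diagonal-bound (<⇒≤ j<c) k≤m))
      (subst (λ k → P₁.Exit c k (proj₁ D₁)) on-diagonal (P₁.viaN (<⇒≤ c<m) (s≤s z≤n) k≤m w₁ (proj₂ D₁)))
    full₂ : P₂.Exit 0 (suc c) (proj₁ D₂)
    full₂ = P₂.rewind (s≤s z≤n) (diagonal-bound ≤-refl k≤m)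
      (λ j<c → R₂.east-on-path (proj₂ (east<c j<c)) (s≤s j<c) (diagonal-bound (<⇒≤ j<c) k≤m))
      (subst (λ k → P₂.Exit c k (proj₁ D₂)) on-diagonal (P₂.viaE (<⇒≤ c<m) (s≤s z≤n) k≤m w₂ (proj₂ D₂)))

  ¬north-on-diagonal : ∀ {c} → (∀ {j} → j < c → East₁ j × East₂ j) → suc (c + c) ≤ m →
                       white T₁ c (suc (c + c)) ≢ N
  ¬north-on-diagonal {c} east<c k≤m w₁ with white T₂ c (suc (c + c)) in w₂
  ... | N = interaction c<m (<⇒≤ k≤m) (proj₂ (white-N T₁ (<⇒≤ c<m) k≤m w₁))
              (proj₂ (white-N T₂ (<⇒≤ c<m) k≤m w₂)) SS
    where
    c<m : c < m
    c<m = diagonal-bound z≤n k≤m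
  ... | W = R₂.¬west 1 (proj₂ ∘ east<c) ≤-refl (s≤s z≤n) k≤m w₂
  ... | S = R₂.¬south 1 (proj₂ ∘ east<c) ≤-refl (s≤s z≤n) k≤m w₂
  ... | E = paths-part-on-diagonal east<c k≤m w₁ w₂

  east₁-column : ∀ {c} → (∀ {j} → j < c → East₁ j × East₂ j) → East₁ c
  east₁-column {c} east<c {suc k} 2c<k+1@(s≤s 2c≤k) k+1≤m with white T₁ c (suc k) in w
  ... | E = refl
  ... | W = ⊥-elim (R₁.¬west 0 (proj₁ ∘ east<c) (<⇒≤ 2c<k+1) (s≤s z≤n) k+1≤m w)
  ... | S = ⊥-elim (R₁.¬south 0 (proj₁ ∘ east<c) (<⇒≤ 2c<k+1) (s≤s z≤n) k+1≤m w)
  ... | N with m≤n⇒m<n∨m≡n 2c≤k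
  ...   | inj₂ refl = ⊥-elim (¬north-on-diagonal east<c k+1≤m w)
  ...   | inj₁ 2c<k =
    ⊥-elim (clash (proj₂ (white-N T₁ c≤m k+1≤m w))
                  (proj₂ (white-E T₁ c≤m (≤-trans (s≤s z≤n) 2c<k) k≤m e)) λ ())
    where
    k≤m : k ≤ m
    k≤m = <⇒≤ k+1≤m
    c≤m : c ≤ m
    c≤m = R₁.column-bound 0 (<⇒≤ 2c<k) k≤m
    e : white T₁ c k ≡ E
    e = east₁-column east<c 2c<k k≤m

  east₂-column : ∀ {c} → (∀ {j} → j < c → East₂ j) → East₁ c → East₂ c
  east₂-column {c} east<c east₁ {suc k} 2c+1<k+1@(s≤s 2c+1≤k) k+1≤m with white T₂ c (suc k) in w
  ... | E = refl
  ... | W = ⊥-elim (R₂.¬west 1 east<c (<⇒≤ 2c+1<k+1) (s≤s z≤n) k+1≤m w)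
  ... | S = ⊥-elim (R₂.¬south 1 east<c (<⇒≤ 2c+1<k+1) (s≤s z≤n) k+1≤m w)
  ... | N = ⊥-elim (interaction c<m k≤m g₁W (proj₂ (white-N T₂ (<⇒≤ c<m) k+1≤m w)) WS)
    where
    k≤m : k ≤ m
    k≤m = <⇒≤ k+1≤m
    c<m : c < m
    c<m = ≤-trans (s≤s (m≤m+n c c)) (≤-trans 2c+1≤k k≤m)
    g₁W : gray T₁ c k ≡ W
    g₁W = proj₂ (white-E T₁ (<⇒≤ c<m) (≤-trans (s≤s z≤n) 2c+1≤k) k≤m (east₁ 2c+1≤k k≤m))

  east-region : ∀ c → East₁ c × East₂ c
  east-region = <-rec _ λ _ east<c →
    let east₁ = east₁-column east<c in east₁ , east₂-column (proj₂ ∘ east<c) east₁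

-- The unit interval [a, a + 1] lies at distance ‖ a ‖ from 0, and [reflect a, reflect a + 1] is its
-- mirror image; the square (a, b) lies in the diamond of rank m iff ‖ a ‖ + ‖ b ‖ < m.
‖_‖ : ℤ → ℕ
‖ + n ‖      = n
‖ -[1+ n ] ‖ = n

reflect : ℤ → ℤ
reflect a = ℤ.- a ℤ.- + 1

endpoint-abs : ∀ a → (∣ a ∣ ≡ ‖ a ‖ × ∣ a ℤ.+ + 1 ∣ ≡ suc ‖ a ‖) ⊎
                     (∣ a ∣ ≡ suc ‖ a ‖ × ∣ a ℤ.+ + 1 ∣ ≡ ‖ a ‖)
endpoint-abs (+ n)        = inj₁ (refl , +-comm n 1)
endpoint-abs -[1+ zero ]  = inj₂ (refl , refl)
endpoint-abs -[1+ suc n ] = inj₂ (refl , refl)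

endpoint-abs-≤ : ∀ a → ∣ a ∣ ≤ suc ‖ a ‖ × ∣ a ℤ.+ + 1 ∣ ≤ suc ‖ a ‖
endpoint-abs-≤ a with endpoint-abs a
... | inj₁ (p , q) = ≤-trans (≤-reflexive p) (n≤1+n _) , ≤-reflexive q
... | inj₂ (p , q) = ≤-reflexive p , ≤-trans (≤-reflexive q) (n≤1+n _)

inAD⇐ : ∀ {m} a b → ‖ a ‖ + ‖ b ‖ < m → InAD m a b
inAD⇐ {m} a b ‖a‖+‖b‖<m =
  Equivalence.to T-≡ $ Equivalence.from T-∧ $
    corner (proj₁ (endpoint-abs-≤ a)) (proj₁ (endpoint-abs-≤ b)) , Equivalence.from T-∧ (
    corner (proj₂ (endpoint-abs-≤ a)) (proj₁ (endpoint-abs-≤ b)) , Equivalence.from T-∧ (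
    corner (proj₁ (endpoint-abs-≤ a)) (proj₂ (endpoint-abs-≤ b)) ,
    corner (proj₂ (endpoint-abs-≤ a)) (proj₂ (endpoint-abs-≤ b))))
  where
  corner : ∀ {x y} → x ≤ suc ‖ a ‖ → y ≤ suc ‖ b ‖ → T (x + y ≤ᵇ suc m)
  corner x≤ y≤ = ≤⇒≤ᵇ (≤-trans (+-mono-≤ x≤ y≤) (s≤s (subst (_≤ m) (sym (+-suc _ _)) ‖a‖+‖b‖<m)))

far-corner : ∀ {m x y k l} → x ≡ suc k → y ≡ suc l → T (x + y ≤ᵇ suc m) → k + l < m
far-corner {m} {k = k} {l} refl refl c = subst (_≤ m) (+-suc k l) (≤-pred (≤ᵇ⇒≤ _ _ c))

inAD⇒ : ∀ {m} a b → InAD m a b → ‖ a ‖ + ‖ b ‖ < m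
inAD⇒ a b inAD with Equivalence.to T-∧ (Equivalence.from T-≡ inAD)
... | c₀₀ , rest with Equivalence.to T-∧ rest
... | c₁₀ , rest′ with Equivalence.to T-∧ rest′
... | c₀₁ , c₁₁ with endpoint-abs a | endpoint-abs b
... | inj₁ (_ , p) | inj₁ (_ , q) = far-corner p q c₁₁
... | inj₁ (_ , p) | inj₂ (q , _) = far-corner p q c₁₀
... | inj₂ (p , _) | inj₁ (_ , q) = far-corner p q c₀₁
... | inj₂ (p , _) | inj₂ (q , _) = far-corner p q c₀₀

‖‖+‖‖< : ∀ {n} a b → a ℤ.+ b ℤ.< + n → a ℤ.+ reflect b ℤ.< + n →
         reflect a ℤ.+ b ℤ.< + n → reflect a ℤ.+ reflect b ℤ.< + n → ‖ a ‖ + ‖ b ‖ < n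
‖‖+‖‖< (+ _)    (+ _)    p _ _ _ = ℤᵖ.drop‿+<+ p
‖‖+‖‖< (+ _)    -[1+ _ ] _ p _ _ = ℤᵖ.drop‿+<+ p
‖‖+‖‖< -[1+ _ ] (+ _)    _ _ p _ = ℤᵖ.drop‿+<+ p
‖‖+‖‖< -[1+ _ ] -[1+ _ ] _ _ _ p = ℤᵖ.drop‿+<+ p

a≤‖a‖ : ∀ a → a ℤ.≤ + ‖ a ‖
a≤‖a‖ (+ _)    = ℤᵖ.≤-refl
a≤‖a‖ -[1+ _ ] = ℤ.-≤+

reflect≤‖a‖ : ∀ a → reflect a ℤ.≤ + ‖ a ‖
reflect≤‖a‖ (+ zero)  = ℤ.-≤+
reflect≤‖a‖ (+ suc _) = ℤ.-≤+
reflect≤‖a‖ -[1+ _ ]  = ℤᵖ.≤-refl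

difference-< : ∀ {z x y n} → z ≡ + x ℤ.- + y → x < n + y → z ℤ.< + n
difference-< {y = y} {n} refl x<n+y =
  subst (_ ℤ.<_) (cancel (+ y) (+ n)) (ℤᵖ.+-monoˡ-< (ℤ.- + y) (ℤ.+<+ x<n+y))
  where
  cancel : ∀ y n → (n ℤ.+ y) ℤ.- y ≡ n
  cancel = ℤ-solve-∀

difference-<⁻¹ : ∀ {z x y n} → z ≡ + x ℤ.- + y → z ℤ.< + n → x < n + y
difference-<⁻¹ {x = x} {y} refl x-y<n =
  ℤᵖ.drop‿+<+ (subst (ℤ._< _) (cancel (+ x) (+ y)) (ℤᵖ.+-monoˡ-< (+ y) x-y<n))
  where
  cancel : ∀ x y → (x ℤ.- y) ℤ.+ y ≡ x
  cancel = ℤ-solve-∀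

white-a : ℕ → ℕ → ℕ → ℤ
white-a m c k = + c ℤ.+ + k ℤ.- + suc m

gray-a : ℕ → ℕ → ℕ → ℤ
gray-a m c k = + c ℤ.+ + k ℤ.- + m

sq-b : ℕ → ℕ → ℤ
sq-b c k = + c ℤ.- + k

sq-b-suc : ∀ c k → sq-b (suc c) (suc k) ≡ sq-b c k
sq-b-suc c k = b≡ (+ c) (+ k)
  where
  b≡ : ∀ c k → (+ 1 ℤ.+ c) ℤ.- (+ 1 ℤ.+ k) ≡ c ℤ.- k
  b≡ = ℤ-solve-∀

gray-a+sq-b : ∀ m c k → gray-a m c k ℤ.+ sq-b c k ≡ + (c + c) ℤ.- + m
gray-a+sq-b m c k = a+b (+ c) (+ k) (+ m)
  where
  a+b : ∀ c k m → (c ℤ.+ k ℤ.- m) ℤ.+ (c ℤ.- k) ≡ (c ℤ.+ c) ℤ.- m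
  a+b = ℤ-solve-∀

white-in : ∀ {m c k} → c ≤ m → 1 ≤ k → k ≤ m → InAD m (white-a m c k) (sq-b c k)
white-in {m} {c} {k} c≤m 1≤k k≤m = inAD⇐ (white-a m c k) (sq-b c k) $ ‖‖+‖‖< (white-a m c k) (sq-b c k)
  (difference-< (a+b (+ c) (+ k) (+ m)) (≤-<-trans (+-mono-≤ c≤m c≤m) (+-monoʳ-< m (n<1+n m))))
  (difference-< (a+rb (+ c) (+ k) (+ m)) (≤-<-trans (+-mono-≤ k≤m k≤m) (+-monoʳ-< m (m<n⇒m<1+n (n<1+n m)))))
  (difference-< (ra+b (+ c) (+ k) (+ m)) (m<m+n m (≤-trans 1≤k (m≤m+n k k))))
  (difference-< (ra+rb (+ c) (+ k) (+ m)) (m<m+n m z<s))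
  where
  a+b : ∀ c k m → (c ℤ.+ k ℤ.- (+ 1 ℤ.+ m)) ℤ.+ (c ℤ.- k) ≡ (c ℤ.+ c) ℤ.- (+ 1 ℤ.+ m)
  a+b = ℤ-solve-∀
  a+rb : ∀ c k m → (c ℤ.+ k ℤ.- (+ 1 ℤ.+ m)) ℤ.+ (ℤ.- (c ℤ.- k) ℤ.- + 1) ≡ (k ℤ.+ k) ℤ.- (+ 2 ℤ.+ m)
  a+rb = ℤ-solve-∀
  ra+b : ∀ c k m → (ℤ.- (c ℤ.+ k ℤ.- (+ 1 ℤ.+ m)) ℤ.- + 1) ℤ.+ (c ℤ.- k) ≡ m ℤ.- (k ℤ.+ k)
  ra+b = ℤ-solve-∀
  ra+rb : ∀ c k m → (ℤ.- (c ℤ.+ k ℤ.- (+ 1 ℤ.+ m)) ℤ.- + 1) ℤ.+ (ℤ.- (c ℤ.- k) ℤ.- + 1) ≡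
                    m ℤ.- (+ 1 ℤ.+ (c ℤ.+ c))
  ra+rb = ℤ-solve-∀

gray-in : ∀ {m c k} → c < m → k ≤ m → InAD m (gray-a m c k) (sq-b c k)
gray-in {m} {c} {k} c<m k≤m = inAD⇐ (gray-a m c k) (sq-b c k) $ ‖‖+‖‖< (gray-a m c k) (sq-b c k)
  (difference-< (gray-a+sq-b m c k) (+-mono-< c<m c<m))
  (difference-< (a+rb (+ c) (+ k) (+ m)) (≤-<-trans (+-mono-≤ k≤m k≤m) (+-monoʳ-< m (n<1+n m))))
  (difference-< (ra+b (+ c) (+ k) (+ m)) (m<m+n m z<s))
  (difference-< (ra+rb (+ c) (+ k) (+ m)) (m<m+n m z<s))
  where
  a+rb : ∀ c k m → (c ℤ.+ k ℤ.- m) ℤ.+ (ℤ.- (c ℤ.- k) ℤ.- + 1) ≡ (k ℤ.+ k) ℤ.- (+ 1 ℤ.+ m)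
  a+rb = ℤ-solve-∀
  ra+b : ∀ c k m → (ℤ.- (c ℤ.+ k ℤ.- m) ℤ.- + 1) ℤ.+ (c ℤ.- k) ≡ m ℤ.- (+ 1 ℤ.+ (k ℤ.+ k))
  ra+b = ℤ-solve-∀
  ra+rb : ∀ c k m → (ℤ.- (c ℤ.+ k ℤ.- m) ℤ.- + 1) ℤ.+ (ℤ.- (c ℤ.- k) ℤ.- + 1) ≡ m ℤ.- (+ 2 ℤ.+ (c ℤ.+ c))
  ra+rb = ℤ-solve-∀

gray-in⇒column : ∀ {m c k} → InAD m (gray-a m c k) (sq-b c k) → c < m
gray-in⇒column {m} {c} {k} inAD = ≰⇒> λ m≤c → <⇒≱ 2c<2m (+-mono-≤ m≤c m≤c)
  where
  2c<2m : c + c < m + m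
  2c<2m = difference-<⁻¹ {n = m} (gray-a+sq-b m c k) $
    ℤᵖ.≤-<-trans (ℤᵖ.+-mono-≤ (a≤‖a‖ (gray-a m c k)) (a≤‖a‖ (sq-b c k)))
                 (ℤ.+<+ (inAD⇒ (gray-a m c k) (sq-b c k) inAD))

outside : ∀ {m} a b → reflect a ℤ.+ reflect b ≡ + m → ¬ InAD m a b
outside {m} a b sum≡m inAD = 1+n≰n (≤-trans (inAD⇒ a b inAD) (ℤᵖ.drop‿+≤+ m≤‖a‖+‖b‖))
  where
  m≤‖a‖+‖b‖ : + m ℤ.≤ + (‖ a ‖ + ‖ b ‖)
  m≤‖a‖+‖b‖ = subst (ℤ._≤ + (‖ a ‖ + ‖ b ‖)) sum≡m (ℤᵖ.+-mono-≤ (reflect≤‖a‖ a) (reflect≤‖a‖ b))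

n*2≡n+n : ∀ n → n * 2 ≡ n + n
n*2≡n+n = solve-∀

[n+n]%2≡0 : ∀ n → (n + n) % 2 ≡ 0
[n+n]%2≡0 n = subst (λ x → x % 2 ≡ 0) (n*2≡n+n n) (m*n%n≡0 n 2)

[1+n+n]%2≡1 : ∀ n → suc (n + n) % 2 ≡ 1
[1+n+n]%2≡1 n = subst (λ x → suc x % 2 ≡ 1) (n*2≡n+n n) ([m+kn]%n≡m%n 1 n 2)

gray-is-gray : ∀ {m} c k → Gray m (gray-a m c k) (sq-b c k)
gray-is-gray {m} c k =
  trans (cong (λ z → ∣ z ∣ % 2 ≡ᵇ 0) (sum (+ c) (+ k) (+ m))) (cong (_≡ᵇ 0) ([n+n]%2≡0 c))
  where
  sum : ∀ c k m → (c ℤ.+ k ℤ.- m) ℤ.+ (c ℤ.- k) ℤ.+ m ≡ c ℤ.+ c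
  sum = ℤ-solve-∀

white-not-gray : ∀ {m} c k → grayᵇ m (white-a m c k) (sq-b c k) ≡ false
white-not-gray {m} zero k = cong (λ z → ∣ z ∣ % 2 ≡ᵇ 0) (sum (+ k) (+ m))
  where
  sum : ∀ k m → (+ 0 ℤ.+ k ℤ.- (+ 1 ℤ.+ m)) ℤ.+ (+ 0 ℤ.- k) ℤ.+ m ≡ ℤ.- + 1
  sum = ℤ-solve-∀
white-not-gray {m} (suc c) k =
  trans (cong (λ z → ∣ z ∣ % 2 ≡ᵇ 0) (sum (+ c) (+ k) (+ m))) (cong (_≡ᵇ 0) ([1+n+n]%2≡1 c))
  where
  sum : ∀ c k m → ((+ 1 ℤ.+ c) ℤ.+ k ℤ.- (+ 1 ℤ.+ m)) ℤ.+ ((+ 1 ℤ.+ c) ℤ.- k) ℤ.+ m ≡ + 1 ℤ.+ (c ℤ.+ c)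
  sum = ℤ-solve-∀

m<n∸o⇒o+m<n : ∀ o {m n} → m < n ∸ o → o + m < n
m<n∸o⇒o+m<n zero              m<n   = m<n
m<n∸o⇒o+m<n (suc o) {n = suc n} m<n∸o = s≤s (m<n∸o⇒o+m<n o m<n∸o)

path-fits : ∀ {m i j} → i ≤ m → j < m ∸ i + 1 → j + i ≤ m
path-fits {m} {i} {j} i≤m j<m-i+1 =
  ≤-trans (+-monoˡ-≤ i (≤-pred (subst (j <_) (+-comm (m ∸ i) 1) j<m-i+1))) (≤-reflexive (m∸n+n≡m i≤m))

module FromTiling {m : ℕ} (T : Tiling m) where

  Matched : Dir → ℤ → ℤ → Set
  Matched X a b = InAD m a b × dir T a b ≡ X

  partner-of : ∀ {a b X} → dir T a b ≡ X → InAD m a b → Matched (opp X) (moveA X a) (moveB X b)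
  partner-of {a} {b} refl inAD = inside T a b inAD , partner T a b inAD

  white gray : ℕ → ℕ → Dir
  white c k = dir T (white-a m c k) (sq-b c k)
  gray  c k = dir T (gray-a m c k) (sq-b c k)

  partner-gray : ∀ c k c′ k′ {X} →
                 moveA X (white-a m c k) ≡ gray-a m c′ k′ → moveB X (sq-b c k) ≡ sq-b c′ k′ →
                 c ≤ m → 1 ≤ k → k ≤ m → white c k ≡ X → c′ < m × gray c′ k′ ≡ opp X
  partner-gray c k _ _ {X} a≡ b≡ c≤m 1≤k k≤m w
    with subst₂ (Matched (opp X)) a≡ b≡ (partner-of w (white-in c≤m 1≤k k≤m))
  ... | inAD , g = gray-in⇒column inAD , g

  north : ∀ {c k} → c ≤ m → suc k ≤ m → white c (suc k) ≡ N → c < m × gray c k ≡ S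
  north {c} {k} c≤m = partner-gray c (suc k) c k (a≡ (+ c) (+ k) (+ m)) (b≡ (+ c) (+ k)) c≤m (s≤s z≤n)
    where
    a≡ : ∀ c k m → c ℤ.+ (+ 1 ℤ.+ k) ℤ.- (+ 1 ℤ.+ m) ≡ c ℤ.+ k ℤ.- m
    a≡ = ℤ-solve-∀
    b≡ : ∀ c k → c ℤ.- (+ 1 ℤ.+ k) ℤ.+ + 1 ≡ c ℤ.- k
    b≡ = ℤ-solve-∀

  east : ∀ {c k} → c ≤ m → 1 ≤ k → k ≤ m → white c k ≡ E → c < m × gray c k ≡ W
  east {c} {k} = partner-gray c k c k (a≡ (+ c) (+ k) (+ m)) refl
    where
    a≡ : ∀ c k m → c ℤ.+ k ℤ.- (+ 1 ℤ.+ m) ℤ.+ + 1 ≡ c ℤ.+ k ℤ.- m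
    a≡ = ℤ-solve-∀

  south : ∀ {c k} → suc c ≤ m → 1 ≤ k → k ≤ m → white (suc c) k ≡ S → gray c k ≡ N
  south {c} {k} c<m 1≤k k≤m =
    proj₂ ∘ partner-gray (suc c) k c k (a≡ (+ c) (+ k) (+ m)) (b≡ (+ c) (+ k)) c<m 1≤k k≤m
    where
    a≡ : ∀ c k m → (+ 1 ℤ.+ c) ℤ.+ k ℤ.- (+ 1 ℤ.+ m) ≡ c ℤ.+ k ℤ.- m
    a≡ = ℤ-solve-∀
    b≡ : ∀ c k → (+ 1 ℤ.+ c) ℤ.- k ℤ.- + 1 ≡ c ℤ.- k
    b≡ = ℤ-solve-∀

  west : ∀ {c k} → suc c ≤ m → suc k ≤ m → white (suc c) (suc k) ≡ W → gray c k ≡ E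
  west {c} {k} c<m k<m =
    proj₂ ∘ partner-gray (suc c) (suc k) c k (a≡ (+ c) (+ k) (+ m)) (sq-b-suc c k) c<m (s≤s z≤n) k<m
    where
    a≡ : ∀ c k m → (+ 1 ℤ.+ c) ℤ.+ (+ 1 ℤ.+ k) ℤ.- (+ 1 ℤ.+ m) ℤ.- + 1 ≡ c ℤ.+ k ℤ.- m
    a≡ = ℤ-solve-∀

  edge-south : ∀ {k} → 1 ≤ k → k ≤ m → white 0 k ≢ S
  edge-south {k} 1≤k k≤m w =
    outside (white-a m 0 k) (sq-b 0 k ℤ.- + 1) (sum (+ k) (+ m))
            (proj₁ (partner-of w (white-in z≤n 1≤k k≤m)))
    where
    sum : ∀ k m → (ℤ.- (+ 0 ℤ.+ k ℤ.- (+ 1 ℤ.+ m)) ℤ.- + 1) ℤ.+ (ℤ.- (+ 0 ℤ.- k ℤ.- + 1) ℤ.- + 1) ≡ m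
    sum = ℤ-solve-∀

  edge-west : ∀ {k} → 1 ≤ k → k ≤ m → white 0 k ≢ W
  edge-west {k} 1≤k k≤m w =
    outside (white-a m 0 k ℤ.- + 1) (sq-b 0 k) (sum (+ k) (+ m))
            (proj₁ (partner-of w (white-in z≤n 1≤k k≤m)))
    where
    sum : ∀ k m → (ℤ.- (+ 0 ℤ.+ k ℤ.- (+ 1 ℤ.+ m) ℤ.- + 1) ℤ.- + 1) ℤ.+ (ℤ.- (+ 0 ℤ.- k) ℤ.- + 1) ≡ m
    sum = ℤ-solve-∀

  matching : Matching m
  matching = record
    { white = white ; gray = gray
    ; white-N = north ; white-E = east ; white-S = south ; white-W = west
    ; edge-S = edge-south ; edge-W = edge-west
    }

  walk-east : ∀ {c k f} → c ≤ m → 1 ≤ k → k ≤ m → white c k ≡ E →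
              walk T (suc f) (white-a m c k) (sq-b c k) ≡
              hor ∷ walk T f (white-a m (suc c) (suc k)) (sq-b (suc c) (suc k))
  walk-east {c} {k} {f} c≤m 1≤k k≤m w rewrite white-in c≤m 1≤k k≤m | white-not-gray {m} c k | w =
    cong₂ (λ a b → hor ∷ walk T f a b) (a≡ (+ c) (+ k) (+ m)) (sym (sq-b-suc c k))
    where
    a≡ : ∀ c k m → c ℤ.+ k ℤ.- (+ 1 ℤ.+ m) ℤ.+ + 2 ≡ (+ 1 ℤ.+ c) ℤ.+ (+ 1 ℤ.+ k) ℤ.- (+ 1 ℤ.+ m)
    a≡ = ℤ-solve-∀

  EastOnPath : ℕ → ℕ → Set
  EastOnPath i j = j + i ≤ m × white j (j + i) ≡ E

  east-prefix : ∀ {i} t c {f} → 1 ≤ i → t ≤ f → (∀ {j} → c ≤ j → j < c + t → EastOnPath i j) →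
                take t (walk T f (white-a m c (c + i)) (sq-b c (c + i))) ≡ replicate t hor
  east-prefix zero _ _ _ _ = refl
  east-prefix {i} (suc t) c {suc f} 1≤i (s≤s t≤f) on-path =
    trans (cong (take (suc t)) (walk-east (≤-trans (m≤m+n c i) c+i≤m) (≤-trans 1≤i (m≤n+m i c)) c+i≤m w))
          (cong (hor ∷_) (east-prefix t (suc c) 1≤i t≤f λ c<j j<c+1+t →
             on-path (<⇒≤ c<j) (subst (_<_ _) (sym (+-suc c t)) j<c+1+t)))
    where
    c+i≤m : c + i ≤ m
    c+i≤m = proj₁ (on-path ≤-refl (m<m+n c z<s))
    w : white c (c + i) ≡ E
    w = proj₂ (on-path ≤-refl (m<m+n c z<s))

  horizontal-start : ∀ δ {i} → 1 ≤ i → i ≤ m → (∀ j → Region.East matching δ j) →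
                     BeginsWithHor (path T i) ((i ∸ δ) ⊓ (m ∸ i + 1))
  horizontal-start δ {i} 1≤i i≤m east =
    trans (cong (λ b → take ℓ (walk T (2 * suc m) (+ i ℤ.- + suc m) b)) (sym (ℤᵖ.+-identityˡ _)))
          (east-prefix ℓ 0 1≤i ℓ≤fuel (λ _ → on-path))
    where
    ℓ : ℕ
    ℓ = (i ∸ δ) ⊓ (m ∸ i + 1)
    ℓ≤fuel : ℓ ≤ 2 * suc m
    ℓ≤fuel = ≤-trans (m⊓n≤m _ _) (≤-trans (m∸n≤m i δ) (≤-trans i≤m (≤-trans (n≤1+n m) (m≤n*m (suc m) 2))))
    on-path : ∀ {j} → j < ℓ → EastOnPath i j
    on-path {j} j<ℓ =
      j+i≤m , Region.east-on-path matching (east j) (m<n∸o⇒o+m<n δ (m<n⊓o⇒m<n _ _ j<ℓ)) j+i≤m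
      where
      j+i≤m : j + i ≤ m
      j+i≤m = path-fits i≤m (m<n⊓o⇒m<o _ _ j<ℓ)

gray-no-interaction : ∀ {m} (T₁ T₂ : Tiling m) → NoInteractions T₁ T₂ → ∀ {c k} → c < m → k ≤ m →
                      ¬ InteractionPair (Matching.gray (FromTiling.matching T₁) c k)
                                        (Matching.gray (FromTiling.matching T₂) c k)
gray-no-interaction {m} _ _ no-interaction {c} {k} c<m k≤m p =
  no-interaction (gray-a m c k) (sq-b c k) (gray-in c<m k≤m , gray-is-gray {m} c k , p)

mainTheorem3 : (m : ℕ) → 1 ≤ m → (T₁ T₂ : Tiling m) → NoInteractions T₁ T₂ →
               (i : ℕ) → 1 ≤ i → i ≤ m →
               BeginsWithHor (path T₁ i) (i ⊓ (m ∸ i + 1)) ×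
               BeginsWithHor (path T₂ i) ((i ∸ 1) ⊓ (m ∸ i + 1))
mainTheorem3 m _ T₁ T₂ no-interaction i 1≤i i≤m =
  FromTiling.horizontal-start T₁ 0 1≤i i≤m (proj₁ ∘ east-region) ,
  FromTiling.horizontal-start T₂ 1 1≤i i≤m (proj₂ ∘ east-region)
  where
  open Horizontal (FromTiling.matching T₁) (FromTiling.matching T₂)
                  (gray-no-interaction T₁ T₂ no-interaction)
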